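{- Let $n\ge 1$. For an $n\times n$ magog matrix $A=(a_{i,j})_{1\le i,j\le n}$, let $c_{i,j}=\sum_{i'=1}^{i}\sum_{j'=1}^{j}a_{i',j'}$ for $0\le i,j\le n$ (empty sums are $0$), and define the $(n+1)\times(n+1)$ matrix $h(A)=(h_{i,j})_{0\le i,j\le n}$ by $h_{i,j}=i+j-2c_{i,j}$. Then $A\mapsto h(A)$ is an explicit bijection from the set $\mathrm{Magog}_n$ of $n\times n$ magog matrices onto the set of magog height-function matrices of order $n$.
   Context: An $n\times n$ square sign matrix is a matrix $A=(a_{i,j})$ with entries in $\{0,1,-1\}$ such that every row sums to $1$, every column sums to $1$, every partial column sum $\sum_{i'=1}^{i}a_{i',j}$ lies in $\{0,1\}$ (for all $i,j$), and every partial row sum $\sum_{j'=1}^{j}a_{i,j'}$ is $\ge 0$ (for all $i,j$). A magog matrix of order $n$ is an $n\times n$ square sign matrix that additionally satisfies, for all $1\le i\le n-2$ and $1\le j\le n-2$, the special inequality $\sum_{j'=1}^{j}a_{i+1,j'}+\sum_{i'=1}^{i+1}a_{i',j+1}-\sum_{i'=1}^{i}a_{i',j}\ge 0$. A magog height-function matrix of order $n$ is an integer matrix $(h_{i,j})_{0\le i,j\le n}$ such that: $h_{0,k}=h_{k,0}=k$ and $h_{n,k}=h_{k,n}=n-k$ for all $0\le k\le n$; $h_{i,j}-h_{i,j-1}=\pm 1$ for all $0\le i\le n$, $1\le j\le n$; $h_{i,j}-h_{i-1,j}\in\{1-2k: k\in\mathbb{Z},\ k\ge 0\}$ for all $1\le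 i\le n$, $0\le j\le n$; and (special inequality) $h_{i+1,j+1}+h_{i,j-1}\le 2h_{i,j}+1$ for all $1\le i\le n-2$, $1\le j\le n-2$. -}

module Defs where

open import Data.Nat as ℕ using (ℕ; zero; suc)
open import Data.Integer as ℤ using (ℤ; +_; _+_; _-_; _*_; _≤_)
open import Data.Fin using (Fin; toℕ; fromℕ<)
open import Data.Nat using (_<?_)
open import Data.Product using (∃; _×_)
open import Data.Sum using (_⊎_)
open import Relation.Nullary using (yes; no)
open import Relation.Binary.PropositionalEquality using (_≡_)

Mat : ℕ → Set
Mat n = Fin n → Fin n → ℤ

-- Entry a_{i,j} with the paper's 1-based indices (1 ≤ i,j ≤ n);
-- out-of-range indices give 0 (never used by the conditions except in empty sums).
entry : {n : ℕ} → Mat n → ℕ → ℕ → ℤ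
entry {n} A zero j = + 0
entry {n} A (suc i) zero = + 0
entry {n} A (suc i) (suc j) with i <? n | j <? n
... | yes p | yes q = A (fromℕ< p) (fromℕ< q)
... | _ | _ = + 0

Σ1 : ℕ → (ℕ → ℤ) → ℤ
Σ1 zero f = + 0
Σ1 (suc m) f = Σ1 m f + f (suc m)

rowPS : {n : ℕ} → Mat n → ℕ → ℕ → ℤ
rowPS A i j = Σ1 j (λ j' → entry A i j')

colPS : {n : ℕ} → Mat n → ℕ → ℕ → ℤ
colPS A i j = Σ1 i (λ i' → entry A i' j)

IsSign : ℤ → Set
IsSign x = (x ≡ + 0) ⊎ (x ≡ + 1) ⊎ (x ≡ ℤ.- (+ 1))

record SquareSignMatrix {n : ℕ} (A : Mat n) : Set where
  field
    entries  : ∀ i j → IsSign (A i j)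
    rowSum   : ∀ i → 1 ℕ.≤ i → i ℕ.≤ n → rowPS A i n ≡ + 1
    colSum   : ∀ j → 1 ℕ.≤ j → j ℕ.≤ n → colPS A n j ≡ + 1
    colPart  : ∀ i j → 1 ℕ.≤ i → i ℕ.≤ n → 1 ℕ.≤ j → j ℕ.≤ n →
               (colPS A i j ≡ + 0) ⊎ (colPS A i j ≡ + 1)
    rowPart  : ∀ i j → 1 ℕ.≤ i → i ℕ.≤ n → 1 ℕ.≤ j → j ℕ.≤ n →
               + 0 ≤ rowPS A i j

record Magog {n : ℕ} (A : Mat n) : Set where
  field
    sign    : SquareSignMatrix A
    special : ∀ i j → 1 ℕ.≤ i → i ℕ.≤ n ℕ.∸ 2 → 1 ℕ.≤ j → j ℕ.≤ n ℕ.∸ 2 →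
              + 0 ≤ (rowPS A (suc i) j + colPS A (suc i) (suc j)) - colPS A i j

HMat : ℕ → Set
HMat n = Fin (suc n) → Fin (suc n) → ℤ

-- Entry h_{i,j} with 0-based indices 0 ≤ i,j ≤ n; out of range gives 0 (unused).
hentry : {n : ℕ} → HMat n → ℕ → ℕ → ℤ
hentry {n} H i j with i <? suc n | j <? suc n
... | yes p | yes q = H (fromℕ< p) (fromℕ< q)
... | _ | _ = + 0

OneMinusEven : ℤ → Set
OneMinusEven d = ∃ λ (k : ℕ) → d ≡ + 1 - + (2 ℕ.* k)

record MagogHeight {n : ℕ} (H : HMat n) : Set where
  private h = hentry H
  field
    top    : ∀ k → k ℕ.≤ n → h 0 k ≡ + k
    left   : ∀ k → k ℕ.≤ n → h k 0 ≡ + k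
    bottom : ∀ k → k ℕ.≤ n → h n k ≡ + (n ℕ.∸ k)
    right  : ∀ k → k ℕ.≤ n → h k n ≡ + (n ℕ.∸ k)
    horiz  : ∀ i j → i ℕ.≤ n → 1 ℕ.≤ j → j ℕ.≤ n →
             (h i j - h i (j ℕ.∸ 1) ≡ + 1) ⊎ (h i j - h i (j ℕ.∸ 1) ≡ ℤ.- (+ 1))
    vert   : ∀ i j → 1 ℕ.≤ i → i ℕ.≤ n → j ℕ.≤ n →
             OneMinusEven (h i j - h (i ℕ.∸ 1) j)
    special : ∀ i j → 1 ℕ.≤ i → i ℕ.≤ n ℕ.∸ 2 → 1 ℕ.≤ j → j ℕ.≤ n ℕ.∸ 2 →
              h (suc i) (suc j) + h i (j ℕ.∸ 1) ≤ (+ 2) * h i j + + 1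

corner : {n : ℕ} → Mat n → ℕ → ℕ → ℤ
corner A i j = Σ1 i (λ i' → Σ1 j (λ j' → entry A i' j'))

hOf : {n : ℕ} → Mat n → HMat n
hOf A i j = + (toℕ i ℕ.+ toℕ j) - (+ 2) * corner A (toℕ i) (toℕ j)

-- Along a row, h changes by
-- 1 − 2·(partial column sum); down a column, by 1 − 2·(partial row sum); and
-- the magog combination of partial sums is half the defect 2h(i,j) + 1 −
-- h(i+1,j+1) − h(i,j−1).  Hence every magog condition on A is equivalent to the
-- corresponding height condition on h: partial column sums in {0,1} to
-- horizontal steps ±1, nonnegative partial row sums to vertical steps 1 − 2k,
-- unit row and column sums to the boundary values n − k, and the two special
-- inequalities to each other.  Conversely, h determines the partial column sums
-- (1 − step)/2, hence a matrix whose height function is h.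
module Submission where

open import Defs
open import Data.Nat using (ℕ; _≤_)
open import Data.Fin using (Fin)
open import Data.Product using (_×_; Σ)
open import Relation.Binary.PropositionalEquality using (_≡_)

open import Data.Nat as ℕ using (zero; suc; z≤n; s≤s; _<_; _<?_; _∸_)
import Data.Nat.Properties as ℕ
open import Data.Integer as ℤ using (ℤ; +_; _+_; _-_; _*_; -_; +≤+)
import Data.Integer.Properties as ℤ
open import Data.Integer.Tactic.RingSolver using (solve-∀)
open import Algebra.Properties.CommutativeSemigroup ℤ.+-commutativeSemigroup using (interchange)
open import Data.Fin using (toℕ; fromℕ<)
import Data.Fin.Properties as Fin
open import Data.Product using (_,_)
open import Data.Sum using (_⊎_; inj₁; inj₂)
open import Data.Empty using (⊥-elim)
open import Relation.Nullary using (yes; no)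
open import Relation.Binary.PropositionalEquality
  using (refl; sym; trans; cong; cong₂; subst; module ≡-Reasoning)

open ≡-Reasoning

IsBit : ℤ → Set
IsBit s = (s ≡ + 0) ⊎ (s ≡ + 1)

IsUnit : ℤ → Set
IsUnit d = (d ≡ + 1) ⊎ (d ≡ - (+ 1))

pos-∸ : ∀ {m n} → n ≤ m → + (m ∸ n) ≡ + m - + n
pos-∸ {m} {n} n≤m = trans (sym (ℤ.≤-⊖ n≤m)) (sym (ℤ.m-n≡m⊖n m n))

i+[j-i]≡j : ∀ i j → i + (j - i) ≡ j
i+[j-i]≡j = solve-∀

[i+j]-i≡j : ∀ i j → (i + j) - i ≡ j
[i+j]-i≡j = solve-∀

≡-via-difference : ∀ {x y x′ y′ : ℤ} → y ≡ y′ → x - y ≡ x′ - y′ → x ≡ x′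
≡-via-difference {x} {y} {x′} {y′} y≡y′ Δ≡Δ′ = begin
  x              ≡⟨ i+[j-i]≡j y x ⟨
  y + (x - y)    ≡⟨ cong₂ _+_ y≡y′ Δ≡Δ′ ⟩
  y′ + (x′ - y′) ≡⟨ i+[j-i]≡j y′ x′ ⟩
  x′             ∎

oneMinusDouble-injective : ∀ {s t} → + 1 - + 2 * s ≡ + 1 - + 2 * t → s ≡ t
oneMinusDouble-injective {s} {t} eq = ℤ.*-cancelˡ-≡ (+ 2) s t (begin
  + 2 * s                   ≡⟨ double s ⟩
  + 1 - (+ 1 - + 2 * s)     ≡⟨ cong (λ u → + 1 - u) eq ⟩
  + 1 - (+ 1 - + 2 * t)     ≡⟨ sym (double t) ⟩
  + 2 * t                   ∎)
  where
  double : ∀ u → + 2 * u ≡ + 1 - (+ 1 - + 2 * u)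
  double = solve-∀

bit⇒unit : ∀ {d s} → d ≡ + 1 - + 2 * s → IsBit s → IsUnit d
bit⇒unit d≡ (inj₁ refl) = inj₁ d≡
bit⇒unit d≡ (inj₂ refl) = inj₂ d≡

unit⇒bit : ∀ {d s} → d ≡ + 1 - + 2 * s → IsUnit d → IsBit s
unit⇒bit d≡ (inj₁ d≡1)  = inj₁ (oneMinusDouble-injective (trans (sym d≡) d≡1))
unit⇒bit d≡ (inj₂ d≡-1) = inj₂ (oneMinusDouble-injective (trans (sym d≡) d≡-1))

nonNeg⇒oneMinusEven : ∀ {d s} → d ≡ + 1 - + 2 * s → + 0 ℤ.≤ s → OneMinusEven d
nonNeg⇒oneMinusEven {s = + k} d≡ _ =
  k , trans d≡ (cong (λ u → + 1 - u) (sym (ℤ.pos-* 2 k)))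

oneMinusEven⇒nonNeg : ∀ {d s} → d ≡ + 1 - + 2 * s → OneMinusEven d → + 0 ℤ.≤ s
oneMinusEven⇒nonNeg {d} {s} d≡ (k , d≡′) =
  subst (+ 0 ℤ.≤_) (oneMinusDouble-injective {+ k} (begin
    + 1 - + 2 * + k   ≡⟨ cong (λ u → + 1 - u) (ℤ.pos-* 2 k) ⟨
    + 1 - + (2 ℕ.* k) ≡⟨ sym d≡′ ⟩
    d                 ≡⟨ d≡ ⟩
    + 1 - + 2 * s     ∎))
    (+≤+ z≤n)

twice-nonNeg⇒≤ : ∀ {x y s} → y - x ≡ + 2 * s → + 0 ℤ.≤ s → x ℤ.≤ y
twice-nonNeg⇒≤ eq 0≤s =
  ℤ.0≤i-j⇒j≤i (subst (+ 0 ℤ.≤_) (sym eq) (ℤ.*-monoˡ-≤-nonNeg (+ 2) 0≤s))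

≤⇒half-nonNeg : ∀ {x y s} → y - x ≡ + 2 * s → x ℤ.≤ y → + 0 ℤ.≤ s
≤⇒half-nonNeg {s = s} eq x≤y =
  ℤ.*-cancelˡ-≤-pos (+ 0) s (+ 2) (subst (+ 0 ℤ.≤_) eq (ℤ.i≤j⇒0≤j-i x≤y))

bit-difference-isSign : ∀ {u v} → IsBit u → IsBit v → IsSign (u - v)
bit-difference-isSign (inj₁ refl) (inj₁ refl) = inj₁ refl
bit-difference-isSign (inj₁ refl) (inj₂ refl) = inj₂ (inj₂ refl)
bit-difference-isSign (inj₂ refl) (inj₁ refl) = inj₂ (inj₁ refl)
bit-difference-isSign (inj₂ refl) (inj₂ refl) = inj₁ refl

heightStep-identity : ∀ x c s → ((+ 1 + x) - + 2 * (c + s)) - (x - + 2 * c) ≡ + 1 - + 2 * s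
heightStep-identity = solve-∀

defect-of-steps : ∀ {a b c d r s t} →
  a - b ≡ + 1 - + 2 * s → b - c ≡ + 1 - + 2 * r → c - d ≡ + 1 - + 2 * t →
  (+ 2 * c + + 1) - (a + d) ≡ + 2 * ((r + s) - t)
defect-of-steps {a} {b} {c} {d} {r} {s} {t} ab bc cd = begin
  (+ 2 * c + + 1) - (a + d)
    ≡⟨ telescope a b c d ⟩
  ((+ 1 - (a - b)) - (b - c)) + (c - d)
    ≡⟨ cong₂ _+_ (cong₂ (λ u v → (+ 1 - u) - v) ab bc) cd ⟩
  ((+ 1 - (+ 1 - + 2 * s)) - (+ 1 - + 2 * r)) + (+ 1 - + 2 * t)
    ≡⟨ collect r s t ⟩
  + 2 * ((r + s) - t) ∎
  where
  telescope : ∀ a b c d → (+ 2 * c + + 1) - (a + d) ≡ ((+ 1 - (a - b)) - (b - c)) + (c - d)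
  telescope = solve-∀
  collect : ∀ r s t →
    ((+ 1 - (+ 1 - + 2 * s)) - (+ 1 - + 2 * r)) + (+ 1 - + 2 * t) ≡ + 2 * ((r + s) - t)
  collect = solve-∀

module _ (n : ℕ) {f : ℕ → ℤ} where

  private
    stepDown : ∀ m x → (m - (+ 1 + x)) - (m - x) ≡ - (+ 1)
    stepDown = solve-∀

  countdown : f 0 ≡ + n → (∀ {k} → suc k ≤ n → f (suc k) - f k ≡ - (+ 1)) →
              ∀ k → k ≤ n → f k ≡ + (n ∸ k)
  countdown f0 step k k≤n = trans (go k≤n) (sym (pos-∸ k≤n))
    where
    go : ∀ {k} → k ≤ n → f k ≡ + n - + k
    go {zero}  _   = trans f0 (sym (ℤ.+-identityʳ (+ n)))
    go {suc k} k<n =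
      ≡-via-difference (go (ℕ.<⇒≤ k<n)) (trans (step k<n) (sym (stepDown (+ n) (+ k))))

  countdown-step : (∀ k → k ≤ n → f k ≡ + (n ∸ k)) →
                   ∀ {k} → suc k ≤ n → f (suc k) - f k ≡ - (+ 1)
  countdown-step fk {k} k<n = begin
    f (suc k) - f k                   ≡⟨ cong₂ _-_ (fk (suc k) k<n) (fk k (ℕ.<⇒≤ k<n)) ⟩
    + (n ∸ suc k) - + (n ∸ k)         ≡⟨ cong₂ _-_ (pos-∸ k<n) (pos-∸ (ℕ.<⇒≤ k<n)) ⟩
    (+ n - (+ 1 + + k)) - (+ n - + k) ≡⟨ stepDown (+ n) (+ k) ⟩
    - (+ 1)                           ∎

1≤m≤n∸2⇒2+m≤n : ∀ {m} n → 1 ≤ m → m ≤ n ∸ 2 → 2 ℕ.+ m ≤ n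
1≤m≤n∸2⇒2+m≤n (suc (suc n)) _ m≤n∸2 = s≤s (s≤s m≤n∸2)
1≤m≤n∸2⇒2+m≤n zero          (s≤s z≤n) ()
1≤m≤n∸2⇒2+m≤n (suc zero)    (s≤s z≤n) ()

Σ1-zero : ∀ m → Σ1 m (λ _ → + 0) ≡ + 0
Σ1-zero zero    = refl
Σ1-zero (suc m) = cong (_+ + 0) (Σ1-zero m)

Σ1-+ : ∀ m (f g : ℕ → ℤ) → Σ1 m (λ k → f k + g k) ≡ Σ1 m f + Σ1 m g
Σ1-+ zero    f g = refl
Σ1-+ (suc m) f g = trans (cong (_+ (f (suc m) + g (suc m))) (Σ1-+ m f g))
                         (interchange (Σ1 m f) (Σ1 m g) (f (suc m)) (g (suc m)))

Σ1-last : ∀ m (f : ℕ → ℤ) → Σ1 (suc m) f - Σ1 m f ≡ f (suc m)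
Σ1-last m f = [i+j]-i≡j (Σ1 m f) (f (suc m))

entry-fromℕ< : ∀ {n} (A : Mat n) {a b} (a<n : a < n) (b<n : b < n) →
               entry A (suc a) (suc b) ≡ A (fromℕ< a<n) (fromℕ< b<n)
entry-fromℕ< {n} A {a} {b} a<n b<n with a <? n | b <? n
... | yes _   | yes _   = refl
... | no a≮n  | _       = ⊥-elim (a≮n a<n)
... | yes _   | no b≮n  = ⊥-elim (b≮n b<n)

entry-toℕ : ∀ {n} (A : Mat n) p q → A p q ≡ entry A (suc (toℕ p)) (suc (toℕ q))
entry-toℕ A p q = sym (trans (entry-fromℕ< A (Fin.toℕ<n p) (Fin.toℕ<n q))
  (cong₂ A (Fin.fromℕ<-toℕ p (Fin.toℕ<n p)) (Fin.fromℕ<-toℕ q (Fin.toℕ<n q))))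

fromEntries : ∀ {n} → (ℕ → ℕ → ℤ) → Mat n
fromEntries a p q = a (suc (toℕ p)) (suc (toℕ q))

entry-fromEntries : ∀ {n} (a : ℕ → ℕ → ℤ) {i j} → i < n → j < n →
                    entry (fromEntries {n} a) (suc i) (suc j) ≡ a (suc i) (suc j)
entry-fromEntries a i<n j<n = trans (entry-fromℕ< (fromEntries a) i<n j<n)
  (cong₂ (λ i j → a (suc i) (suc j)) (Fin.toℕ-fromℕ< i<n) (Fin.toℕ-fromℕ< j<n))

hentry-fromℕ< : ∀ {n} (H : HMat n) {i j} (i<n : i < suc n) (j<n : j < suc n) →
                hentry H i j ≡ H (fromℕ< i<n) (fromℕ< j<n)
hentry-fromℕ< {n} H {i} {j} i<n j<n with i <? suc n | j <? suc n
... | yes _   | yes _   = refl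
... | no i≮n  | _       = ⊥-elim (i≮n i<n)
... | yes _   | no j≮n  = ⊥-elim (j≮n j<n)

hentry-toℕ : ∀ {n} (H : HMat n) p q → H p q ≡ hentry H (toℕ p) (toℕ q)
hentry-toℕ H p q = sym (trans (hentry-fromℕ< H (Fin.toℕ<n p) (Fin.toℕ<n q))
  (cong₂ H (Fin.fromℕ<-toℕ p (Fin.toℕ<n p)) (Fin.fromℕ<-toℕ q (Fin.toℕ<n q))))

height : ∀ {n} → Mat n → ℕ → ℕ → ℤ
height A i j = + (i ℕ.+ j) - + 2 * corner A i j

hOf-fromℕ< : ∀ {n} (A : Mat n) {i j} (i≤n : i ≤ n) (j≤n : j ≤ n) →
             hOf A (fromℕ< (s≤s i≤n)) (fromℕ< (s≤s j≤n)) ≡ height A i j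
hOf-fromℕ< A i≤n j≤n =
  cong₂ (height A) (Fin.toℕ-fromℕ< (s≤s i≤n)) (Fin.toℕ-fromℕ< (s≤s j≤n))

hentry-hOf : ∀ {n} (A : Mat n) {i j} → i ≤ n → j ≤ n → hentry (hOf A) i j ≡ height A i j
hentry-hOf A i≤n j≤n =
  trans (hentry-fromℕ< (hOf A) (s≤s i≤n) (s≤s j≤n)) (hOf-fromℕ< A i≤n j≤n)

module _ {n : ℕ} (A : Mat n) where

  corner-sucʳ : ∀ i j → corner A i (suc j) ≡ corner A i j + colPS A i (suc j)
  corner-sucʳ i j = Σ1-+ i (λ i′ → Σ1 j (entry A i′)) (λ i′ → entry A i′ (suc j))

  height-top : ∀ k → height A 0 k ≡ + k
  height-top k = cong +_ (ℕ.+-identityʳ k)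

  height-left : ∀ k → height A k 0 ≡ + k
  height-left k = trans (cong₂ (λ m c → + m - + 2 * c) (ℕ.+-identityʳ k) (Σ1-zero k))
                        (ℤ.+-identityʳ (+ k))

  height-horizStep : ∀ i j → height A i (suc j) - height A i j ≡ + 1 - + 2 * colPS A i (suc j)
  height-horizStep i j =
    trans (cong₂ (λ m c → (+ m - + 2 * c) - height A i j) (ℕ.+-suc i j) (corner-sucʳ i j))
          (heightStep-identity (+ (i ℕ.+ j)) (corner A i j) (colPS A i (suc j)))

  height-vertStep : ∀ i j → height A (suc i) j - height A i j ≡ + 1 - + 2 * rowPS A (suc i) j
  height-vertStep i j = heightStep-identity (+ (i ℕ.+ j)) (corner A i j) (rowPS A (suc i) j)

module Correspondence {n : ℕ} (A : Mat n) (H : HMat n)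
  (agree : ∀ {i j} → i ≤ n → j ≤ n → height A i j ≡ hentry H i j) where

  h : ℕ → ℕ → ℤ
  h = hentry H

  horizStep : ∀ {i j} → i ≤ n → suc j ≤ n →
              h i (suc j) - h i j ≡ + 1 - + 2 * colPS A i (suc j)
  horizStep {i} {j} i≤n j<n =
    trans (sym (cong₂ _-_ (agree i≤n j<n) (agree i≤n (ℕ.<⇒≤ j<n)))) (height-horizStep A i j)

  vertStep : ∀ {i j} → suc i ≤ n → j ≤ n →
             h (suc i) j - h i j ≡ + 1 - + 2 * rowPS A (suc i) j
  vertStep {i} {j} i<n j≤n =
    trans (sym (cong₂ _-_ (agree i<n j≤n) (agree (ℕ.<⇒≤ i<n) j≤n))) (height-vertStep A i j)

  specialDefect : ∀ {i j} → 1 ≤ i → i ≤ n ∸ 2 → suc j ≤ n ∸ 2 →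
    (+ 2 * h i (suc j) + + 1) - (h (suc i) (suc (suc j)) + h i j)
      ≡ + 2 * ((rowPS A (suc i) (suc j) + colPS A (suc i) (suc (suc j))) - colPS A i (suc j))
  specialDefect {i} {j} 1≤i i≤n∸2 j<n∸2 =
    defect-of-steps {h (suc i) (suc (suc j))} {h (suc i) (suc j)} {h i (suc j)} {h i j}
      {rowPS A (suc i) (suc j)} {colPS A (suc i) (suc (suc j))} {colPS A i (suc j)}
    (horizStep {suc i} {suc j} i<n j+2≤n) (vertStep {i} {suc j} i<n (ℕ.<⇒≤ j+2≤n))
    (horizStep {i} {j} (ℕ.<⇒≤ i<n) (ℕ.<⇒≤ j+2≤n))
    where
    i<n = ℕ.<⇒≤ (1≤m≤n∸2⇒2+m≤n n 1≤i i≤n∸2)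
    j+2≤n = ℕ.<⇒≤ (1≤m≤n∸2⇒2+m≤n n (s≤s z≤n) j<n∸2)

  magog⇒height : Magog A → MagogHeight H
  magog⇒height MA = record
    { top = top ; left = left ; bottom = bottom ; right = right
    ; horiz = horiz ; vert = vert ; special = special }
    where
    open Magog MA renaming (special to magog-special)
    open SquareSignMatrix sign

    top : ∀ k → k ≤ n → h 0 k ≡ + k
    top k k≤n = trans (sym (agree z≤n k≤n)) (height-top A k)

    left : ∀ k → k ≤ n → h k 0 ≡ + k
    left k k≤n = trans (sym (agree k≤n z≤n)) (height-left A k)

    bottom : ∀ k → k ≤ n → h n k ≡ + (n ∸ k)
    bottom = countdown n (left n ℕ.≤-refl) λ k<n →
      trans (horizStep ℕ.≤-refl k<n) (cong (λ s → + 1 - + 2 * s) (colSum _ (s≤s z≤n) k<n))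

    right : ∀ k → k ≤ n → h k n ≡ + (n ∸ k)
    right = countdown n (top n ℕ.≤-refl) λ k<n →
      trans (vertStep k<n ℕ.≤-refl) (cong (λ s → + 1 - + 2 * s) (rowSum _ (s≤s z≤n) k<n))

    colPS-bit : ∀ {i j} → i ≤ n → suc j ≤ n → IsBit (colPS A i (suc j))
    colPS-bit {zero}  _   _   = inj₁ refl
    colPS-bit {suc i} i<n j<n = colPart (suc i) _ (s≤s z≤n) i<n (s≤s z≤n) j<n

    rowPS-nonNeg : ∀ {i j} → suc i ≤ n → j ≤ n → + 0 ℤ.≤ rowPS A (suc i) j
    rowPS-nonNeg {j = zero}  _   _   = +≤+ z≤n
    rowPS-nonNeg {j = suc j} i<n j≤n = rowPart _ (suc j) (s≤s z≤n) i<n (s≤s z≤n) j≤n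

    horiz : ∀ i j → i ≤ n → 1 ≤ j → j ≤ n → IsUnit (h i j - h i (j ∸ 1))
    horiz i (suc j) i≤n _ j<n = bit⇒unit (horizStep i≤n j<n) (colPS-bit i≤n j<n)

    vert : ∀ i j → 1 ≤ i → i ≤ n → j ≤ n → OneMinusEven (h i j - h (i ∸ 1) j)
    vert (suc i) j _ i<n j≤n = nonNeg⇒oneMinusEven (vertStep i<n j≤n) (rowPS-nonNeg i<n j≤n)

    special : ∀ i j → 1 ≤ i → i ≤ n ∸ 2 → 1 ≤ j → j ≤ n ∸ 2 →
              h (suc i) (suc j) + h i (j ∸ 1) ℤ.≤ + 2 * h i j + + 1
    special i (suc j) 1≤i i≤n∸2 _ j≤n∸2 = twice-nonNeg⇒≤
      (specialDefect 1≤i i≤n∸2 j≤n∸2)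
      (magog-special i (suc j) 1≤i i≤n∸2 (s≤s z≤n) j≤n∸2)

  height⇒magog : MagogHeight H → Magog A
  height⇒magog MH = record
    { sign = record
      { entries = entries ; rowSum = rowSum ; colSum = colSum
      ; colPart = colPart ; rowPart = rowPart }
    ; special = special }
    where
    open MagogHeight MH renaming (special to height-special)

    colPS-bit : ∀ {i j} → i ≤ n → suc j ≤ n → IsBit (colPS A i (suc j))
    colPS-bit i≤n j<n = unit⇒bit (horizStep i≤n j<n) (horiz _ _ i≤n (s≤s z≤n) j<n)

    entries : ∀ p q → IsSign (A p q)
    entries p q = subst IsSign
      (trans (Σ1-last (toℕ p) (λ i → entry A i (suc (toℕ q)))) (sym (entry-toℕ A p q)))
      (bit-difference-isSign (colPS-bit (Fin.toℕ<n p) (Fin.toℕ<n q))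
                             (colPS-bit (ℕ.<⇒≤ (Fin.toℕ<n p)) (Fin.toℕ<n q)))

    rowSum : ∀ i → 1 ≤ i → i ≤ n → rowPS A i n ≡ + 1
    rowSum (suc i) _ i<n = oneMinusDouble-injective
      (trans (sym (vertStep i<n ℕ.≤-refl)) (countdown-step n right i<n))

    colSum : ∀ j → 1 ≤ j → j ≤ n → colPS A n j ≡ + 1
    colSum (suc j) _ j<n = oneMinusDouble-injective
      (trans (sym (horizStep ℕ.≤-refl j<n)) (countdown-step n bottom j<n))

    colPart : ∀ i j → 1 ≤ i → i ≤ n → 1 ≤ j → j ≤ n → IsBit (colPS A i j)
    colPart i (suc j) _ i≤n _ j<n = colPS-bit i≤n j<n

    rowPart : ∀ i j → 1 ≤ i → i ≤ n → 1 ≤ j → j ≤ n → + 0 ℤ.≤ rowPS A i j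
    rowPart (suc i) j _ i<n _ j≤n =
      oneMinusEven⇒nonNeg (vertStep i<n j≤n) (vert (suc i) j (s≤s z≤n) i<n j≤n)

    special : ∀ i j → 1 ≤ i → i ≤ n ∸ 2 → 1 ≤ j → j ≤ n ∸ 2 →
              + 0 ℤ.≤ (rowPS A (suc i) j + colPS A (suc i) (suc j)) - colPS A i j
    special i (suc j) 1≤i i≤n∸2 _ j≤n∸2 = ≤⇒half-nonNeg
      (specialDefect 1≤i i≤n∸2 j≤n∸2)
      (height-special i (suc j) 1≤i i≤n∸2 (s≤s z≤n) j≤n∸2)

-- (1 − d)/2 for d = ±1; the value on other integers is irrelevant.
descentBit : ℤ → ℤ
descentBit (+ 1) = + 0
descentBit _     = + 1

descentBit-spec : ∀ {d} → IsUnit d → d ≡ + 1 - + 2 * descentBit d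
descentBit-spec (inj₁ refl) = refl
descentBit-spec (inj₂ refl) = refl

module FromHeight {n : ℕ} (H : HMat n) (MH : MagogHeight H) where
  open MagogHeight MH using (top; left; horiz)

  h : ℕ → ℕ → ℤ
  h = hentry H

  colBit : ℕ → ℕ → ℤ
  colBit i j = descentBit (h i j - h i (j ∸ 1))

  entryFromBits : ℕ → ℕ → ℤ
  entryFromBits i j = colBit i j - colBit (i ∸ 1) j

  matrix : Mat n
  matrix = fromEntries entryFromBits

  colPS-matrix : ∀ {i j} → i ≤ n → suc j ≤ n →
                 colPS matrix i (suc j) ≡ colBit i (suc j)
  colPS-matrix {zero} {j} _ j<n = sym (cong descentBit (begin
    h 0 (suc j) - h 0 j ≡⟨ cong₂ _-_ (top (suc j) j<n) (top j (ℕ.<⇒≤ j<n)) ⟩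
    + 1 + + j - + j     ≡⟨ cancel (+ j) ⟩
    + 1                 ∎))
    where
    cancel : ∀ x → + 1 + x - x ≡ + 1
    cancel = solve-∀
  colPS-matrix {suc i} {j} i<n j<n = begin
    colPS matrix i (suc j) + entry matrix (suc i) (suc j)
      ≡⟨ cong₂ _+_ (colPS-matrix (ℕ.<⇒≤ i<n) j<n) (entry-fromEntries entryFromBits i<n j<n) ⟩
    colBit i (suc j) + (colBit (suc i) (suc j) - colBit i (suc j))
      ≡⟨ i+[j-i]≡j (colBit i (suc j)) (colBit (suc i) (suc j)) ⟩
    colBit (suc i) (suc j) ∎

  height-matrix : ∀ {i j} → i ≤ n → j ≤ n → height matrix i j ≡ h i j
  height-matrix {i} {zero}  i≤n _   = trans (height-left matrix i) (sym (left i i≤n))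
  height-matrix {i} {suc j} i≤n j<n =
    ≡-via-difference (height-matrix i≤n (ℕ.<⇒≤ j<n)) (begin
      height matrix i (suc j) - height matrix i j
        ≡⟨ height-horizStep matrix i j ⟩
      + 1 - + 2 * colPS matrix i (suc j)
        ≡⟨ cong (λ s → + 1 - + 2 * s) (colPS-matrix i≤n j<n) ⟩
      + 1 - + 2 * colBit i (suc j)
        ≡⟨ descentBit-spec (horiz i (suc j) i≤n (s≤s z≤n) j<n) ⟨
      h i (suc j) - h i j ∎)

  hOf-matrix : ∀ p q → hOf matrix p q ≡ H p q
  hOf-matrix p q =
    trans (height-matrix (Fin.toℕ≤pred[n] p) (Fin.toℕ≤pred[n] q)) (sym (hentry-toℕ H p q))

  magog : Magog matrix
  magog = Correspondence.height⇒magog matrix H height-matrix MH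

-- Heights determine the partial row sums, and these determine the entries.
hOf-injective : ∀ {n} (A B : Mat n) →
                (∀ p q → hOf A p q ≡ hOf B p q) → ∀ p q → A p q ≡ B p q
hOf-injective {n} A B sameHOf p q = begin
  A p q                                       ≡⟨ entry-toℕ A p q ⟩
  entry A (suc a) (suc b)                     ≡⟨ Σ1-last b (entry A (suc a)) ⟨
  rowPS A (suc a) (suc b) - rowPS A (suc a) b ≡⟨ cong₂ _-_ (same-rowPS (suc b) b<n)
                                                           (same-rowPS b (ℕ.<⇒≤ b<n)) ⟩
  rowPS B (suc a) (suc b) - rowPS B (suc a) b ≡⟨ Σ1-last b (entry B (suc a)) ⟩
  entry B (suc a) (suc b)                     ≡⟨ entry-toℕ B p q ⟨
  B p q                                       ∎
  where
  a = toℕ p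
  b = toℕ q
  a<n = Fin.toℕ<n p
  b<n = Fin.toℕ<n q

  same : ∀ {i j} → i ≤ n → j ≤ n → height A i j ≡ height B i j
  same {i} {j} i≤n j≤n = begin
    height A i j                                ≡⟨ hOf-fromℕ< A i≤n j≤n ⟨
    hOf A (fromℕ< (s≤s i≤n)) (fromℕ< (s≤s j≤n)) ≡⟨ sameHOf (fromℕ< (s≤s i≤n)) (fromℕ< (s≤s j≤n)) ⟩
    hOf B (fromℕ< (s≤s i≤n)) (fromℕ< (s≤s j≤n)) ≡⟨ hOf-fromℕ< B i≤n j≤n ⟩
    height B i j                                ∎

  same-rowPS : ∀ j → j ≤ n → rowPS A (suc a) j ≡ rowPS B (suc a) j
  same-rowPS j j≤n = oneMinusDouble-injective (begin
    + 1 - + 2 * rowPS A (suc a) j       ≡⟨ sym (height-vertStep A a j) ⟩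
    height A (suc a) j - height A a j   ≡⟨ cong₂ _-_ (same a<n j≤n) (same (ℕ.<⇒≤ a<n) j≤n) ⟩
    height B (suc a) j - height B a j   ≡⟨ height-vertStep B a j ⟩
    + 1 - + 2 * rowPS B (suc a) j       ∎)

lemma4p5 : (n : ℕ) → 1 ≤ n →
    ((A : Mat n) → Magog A → MagogHeight (hOf A))
    × ((A B : Mat n) → Magog A → Magog B →
         (∀ i j → hOf A i j ≡ hOf B i j) → ∀ i j → A i j ≡ B i j)
    × ((H : HMat n) → MagogHeight H →
         Σ (Mat n) (λ A → Magog A × (∀ i j → hOf A i j ≡ H i j)))
lemma4p5 n _ = into , injective , onto
  where
  into : (A : Mat n) → Magog A → MagogHeight (hOf A)
  into A = Correspondence.magog⇒height A (hOf A) λ i≤n j≤n → sym (hentry-hOf A i≤n j≤n)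

  injective : (A B : Mat n) → Magog A → Magog B →
              (∀ i j → hOf A i j ≡ hOf B i j) → ∀ i j → A i j ≡ B i j
  injective A B _ _ = hOf-injective A B

  onto : (H : HMat n) → MagogHeight H →
         Σ (Mat n) (λ A → Magog A × (∀ i j → hOf A i j ≡ H i j))
  onto H MH = matrix , magog , hOf-matrix
    where open FromHeight H MH
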